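{- Proof search in the sequent calculus $\mathbf{LMT}^{\rightarrow}$ following the strategy $\mathcal{S}$-$\mathbf{LMT}^{\rightarrow}$ always terminates.
   Context: Formulas of $\mathbf{M}^{\rightarrow}$ are built from atoms using only $\rightarrow$. $\mathbf{LMT}^{\rightarrow}$ sequents have the form $\{\Delta'\},\Upsilon_1^{p_1},\dots,\Upsilon_n^{p_n},\Delta\Rightarrow[p_1,\dots,p_n],\varphi$, where $\varphi$ is a formula, $\Delta,\Upsilon_1,\dots,\Upsilon_n$ are multisets of formulas, $\Upsilon_i^{p_i}$ means the formulas of $\Upsilon_i$ carry the label $p_i$, $\Delta'$ is a set of formulas (the focused formulas; the braces are an annotation), and $p_1,\dots,p_n$ is a repetition-free sequence of atoms (the []-area). $\Delta^q$ is a copy of $\Delta$ with every formula labelled $q$; $\Upsilon_i$ without superscript denotes the formulas of $\Upsilon_i^{p_i}$ with labels removed. Write $\overline{\Upsilon}$ for $\Upsilon_1^{p_1},\dots,\Upsilon_n^{p_n}$ and $\bar p$ for $p_1,\dots,p_n$. In each rule $\Delta'\subseteq\Delta$. Rules: Axiom: $\{\Delta',q\},\overline{\Upsilon},\Delta\Rightarrow[\bar p],q$. Focus: from $\{\Delta',\alpha\},\overline{\Upsilon},\Delta,\alpha\Rightarrow[\bar p],\beta$ infer $\{\Delta'\},\overline{\Upsilon},\Delta,\alpha\Rightarrow[\bar p],\beta$. Restart: from $\{\},\Upsilon_1,\dots,\Upsilon_i,\Upsilon_{i+1}^{p_{i+1}},\dots,\Upsilon_n^{p_n},\Delta^q\Rightarrow[p_1,p_2,\dots,p_{i+1},\dots,p_n,q],p_i$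 infer $\{\Delta'\},\Upsilon_1^{p_1},\dots,\Upsilon_n^{p_n},\Delta\Rightarrow[p_1,\dots,p_n],q$. $\rightarrow$-right: from $\{\Delta'\},\overline{\Upsilon},\Delta,\alpha\Rightarrow[\bar p],\beta$ infer $\{\Delta'\},\overline{\Upsilon},\Delta\Rightarrow[\bar p],\alpha\rightarrow\beta$. $\rightarrow$-left (context $(\alpha\rightarrow\beta,q)$): from $\{\alpha\rightarrow\beta,\Delta'\},\overline{\Upsilon},\Delta^q,\Delta\Rightarrow[\bar p,q],\alpha$ and $\{\alpha\rightarrow\beta,\Delta'\},\overline{\Upsilon},\Delta,\beta\Rightarrow[\bar p],q$ infer $\{\alpha\rightarrow\beta,\Delta'\},\overline{\Upsilon},\Delta\Rightarrow[\bar p],q$. Strategy $\mathcal{S}$-$\mathbf{LMT}^{\rightarrow}$ (bottom-up from $\{\}\Rightarrow[],\alpha$): for each goal (leaf) sequent, if it is an axiom the branch closes; otherwise apply the first applicable of: (1) $\rightarrow$-right if the formula on the right outside the []-area is not atomic; (2) focus on some formula of $\Delta$ not in $\Delta'$; (3) if all left formulas are focused, apply $\rightarrow$-left to the first $\alpha\in\Delta'$ whose context $(\alpha,q)$ ($q$ the atom on the right outside the []-area) has not been used in an $\rightarrow$-left application since the last restart on the branch; (4) apply restart with the leftmost atom of the []-area not chosen before in this branch. -}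

module Defs where

open import Data.Nat using (ℕ; _≡ᵇ_)
open import Data.Bool using (Bool; true; false; _∨_; not; if_then_else_)
open import Data.List using (List; []; _∷_; _++_; map; filterᵇ)
open import Data.List.Membership.Propositional using (_∈_; _∉_)
open import Data.List.Relation.Unary.All using (All)
open import Data.Product using (_×_; _,_; proj₁; proj₂; ∃)
open import Relation.Binary.PropositionalEquality using (_≡_)
open import Relation.Nullary using (¬_)

Atom : Set
Atom = ℕ

infixr 5 _⊃_
data Fm : Set where
  atom : Atom → Fm
  _⊃_  : Fm → Fm → Fm

memᵇ : Atom → List Atom → Bool
memᵇ q []       = false
memᵇ q (p ∷ ps) = (q ≡ᵇ p) ∨ memᵇ q ps

labelWith : Atom → List Fm → List (Fm × Atom)
labelWith q Δ = map (λ φ → (φ , q)) Δ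

unlabel : List Atom → List (Fm × Atom) → List Fm
unlabel ps Υ = map proj₁ (filterᵇ (λ x → memᵇ (proj₂ x) ps) Υ)

keepLabelled : List Atom → List (Fm × Atom) → List (Fm × Atom)
keepLabelled ps Υ = filterᵇ (λ x → not (memᵇ (proj₂ x) ps)) Υ

-- Append q to the (repetition-free) []-area; if q already occurs there,
-- the area is unchanged (formulas labelled q simply join Υ_q).
addAtom : Atom → List Atom → List Atom
addAtom q ps = if memᵇ q ps then ps else ps ++ (q ∷ [])

-- A goal of the proof search:
--   focused  = Δ'  (set of focused formulas, represented as a list)
--   labelled = Υ_1^{p_1},…,Υ_n^{p_n}  (formula/label pairs)
--   ctx      = Δ   (multiset of unlabelled formulas)
--   area     = [p_1,…,p_n]
--   goal     = φ   (formula on the right outside the []-area)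
-- plus the branch bookkeeping required by the strategy:
--   restarted = atoms already chosen for restart on this branch
--   usedCtx   = contexts (α , q) used by →-left since the last restart
record State : Set where
  constructor st
  field
    focused   : List Fm
    labelled  : List (Fm × Atom)
    ctx       : List Fm
    area      : List Atom
    goal      : Fm
    restarted : List Atom
    usedCtx   : List (Fm × Atom)

IsAxiom : State → Set
IsAxiom (st F L D A g R U) = ∃ λ q → (g ≡ atom q) × (atom q ∈ F)

-- Axioms are never expanded (the branch closes); a goal to which no
-- case applies is an (open) leaf.
data Expand : State → List State → Set where
  ⊃right : ∀ {F L D A R U} α β →
    Expand (st F L D A (α ⊃ β) R U)
           (st F L (α ∷ D) A β R U ∷ [])
  focus : ∀ {F L D A R U} q α →
    ¬ IsAxiom (st F L D A (atom q) R U) →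
    α ∈ D → α ∉ F →
    Expand (st F L D A (atom q) R U)
           (st (α ∷ F) L D A (atom q) R U ∷ [])
  ⊃left : ∀ {F L D A R U} q α β →
    ¬ IsAxiom (st F L D A (atom q) R U) →
    All (_∈ F) D →
    (α ⊃ β) ∈ F → ((α ⊃ β) , q) ∉ U →
    Expand (st F L D A (atom q) R U)
           ( st F (L ++ labelWith q D) D (addAtom q A) α R (((α ⊃ β) , q) ∷ U)
           ∷ st F L (β ∷ D) A (atom q) R (((α ⊃ β) , q) ∷ U)
           ∷ [])
  restart : ∀ {F L D A R U} q pre p post →
    ¬ IsAxiom (st F L D A (atom q) R U) →
    All (_∈ F) D →
    (∀ α β → (α ⊃ β) ∈ F → ((α ⊃ β) , q) ∈ U) →
    A ≡ pre ++ (p ∷ post) →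
    All (_∈ R) pre → p ∉ R →
    Expand (st F L D A (atom q) R U)
           (st [] (keepLabelled (pre ++ (p ∷ [])) L ++ labelWith q D)
               (unlabel (pre ++ (p ∷ [])) L) (addAtom q A) (atom p)
               (p ∷ R) [] ∷ [])

Child : State → State → Set
Child s' s = ∃ λ ss → Expand s ss × s' ∈ ss

initial : Fm → State
initial φ = st [] [] [] [] φ [] []

-- Every formula occurring in a sequent of the search for φ is a subformula of φ,
-- and every atom in a []-area occurs in φ.  Hence the atoms that may still be
-- chosen for a restart, the contexts (α ⊃ β , q) that may still be used by
-- →-left, and the formulas that may still be focused are drawn from fixed
-- finite sets.  Restart consumes a fresh atom, →-left a fresh context, focus a
-- fresh formula, and →-right shrinks the goal; ordering the four quantities
-- lexicographically in this order, every step of the strategy decreases them.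
module Submission where

open import Defs
open import Level using (0ℓ)
open import Function using (_∘_)
open import Induction.WellFounded using (Acc; acc; WellFounded)
open import Data.Nat using (ℕ; suc; _+_; _≤_; _<_; z≤n; s≤s)
open import Data.Nat.Properties using (m≤n+m; m≤n⇒m≤1+n)
open import Data.Nat.Induction using (<-wellFounded)
open import Data.Bool using (true; false)
open import Data.List using (List; []; _∷_; _++_; length; filter; cartesianProduct)
open import Data.List.Relation.Unary.Any using (here; there)
open import Data.List.Relation.Unary.All using (All; []; _∷_; lookup)
open import Data.List.Relation.Unary.All.Properties using (map⁺; ++⁺; filter⁺)
open import Data.List.Membership.Propositional using (_∈_; _∉_)
open import Data.List.Membership.Propositional.Properties using (∈-++⁺ˡ; ∈-++⁺ʳ; ∈-cartesianProduct⁺)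
import Data.List.Membership.DecPropositional as DecMembership
open import Data.Product using (_×_; _,_; proj₁)
open import Data.Product.Properties using (≡-dec)
open import Data.Product.Relation.Binary.Lex.Strict using (×-Lex; ×-wellFounded)
open import Data.Sum using (inj₁; inj₂)
open import Relation.Binary using (Rel; DecidableEquality)
open import Relation.Binary.PropositionalEquality using (_≡_; refl)
open import Relation.Nullary using (¬_; yes; no; contradiction)
open import Relation.Unary using (Pred; Decidable)

import Data.Nat as ℕ

_≟_ : DecidableEquality Fm
atom p  ≟ atom q with p ℕ.≟ q
... | yes refl = yes refl
... | no p≢q   = no λ { refl → p≢q refl }
atom _  ≟ (_ ⊃ _) = no λ ()
(_ ⊃ _) ≟ atom _  = no λ ()
(α ⊃ β) ≟ (γ ⊃ δ) with α ≟ γ | β ≟ δ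
... | yes refl | yes refl = yes refl
... | no α≢γ   | _        = no λ { refl → α≢γ refl }
... | _        | no β≢δ   = no λ { refl → β≢δ refl }

infix 4 _⊑_

data _⊑_ : Fm → Fm → Set where
  ⊑-refl : ∀ {ψ} → ψ ⊑ ψ
  ⊑-⊃ˡ   : ∀ {ψ α β} → ψ ⊑ α → ψ ⊑ α ⊃ β
  ⊑-⊃ʳ   : ∀ {ψ α β} → ψ ⊑ β → ψ ⊑ α ⊃ β

⊑-trans : ∀ {ψ χ φ} → ψ ⊑ χ → χ ⊑ φ → ψ ⊑ φ
⊑-trans ψ⊑χ ⊑-refl       = ψ⊑χ
⊑-trans ψ⊑χ (⊑-⊃ˡ χ⊑α)   = ⊑-⊃ˡ (⊑-trans ψ⊑χ χ⊑α)
⊑-trans ψ⊑χ (⊑-⊃ʳ χ⊑β)   = ⊑-⊃ʳ (⊑-trans ψ⊑χ χ⊑β)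

antecedent-⊑ : ∀ {α β φ} → α ⊃ β ⊑ φ → α ⊑ φ
antecedent-⊑ = ⊑-trans (⊑-⊃ˡ ⊑-refl)

consequent-⊑ : ∀ {α β φ} → α ⊃ β ⊑ φ → β ⊑ φ
consequent-⊑ = ⊑-trans (⊑-⊃ʳ ⊑-refl)

subformulas : Fm → List Fm
subformulas (atom q) = atom q ∷ []
subformulas (α ⊃ β) = (α ⊃ β) ∷ subformulas α ++ subformulas β

∈-subformulas : ∀ {ψ φ} → ψ ⊑ φ → ψ ∈ subformulas φ
∈-subformulas {φ = atom _} ⊑-refl = here refl
∈-subformulas {φ = _ ⊃ _} ⊑-refl = here refl
∈-subformulas (⊑-⊃ˡ ψ⊑α) = there (∈-++⁺ˡ (∈-subformulas ψ⊑α))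
∈-subformulas {φ = α ⊃ _} (⊑-⊃ʳ ψ⊑β) = there (∈-++⁺ʳ (subformulas α) (∈-subformulas ψ⊑β))

atoms : Fm → List Atom
atoms (atom q) = q ∷ []
atoms (α ⊃ β) = atoms α ++ atoms β

∈-atoms : ∀ {q φ} → atom q ⊑ φ → q ∈ atoms φ
∈-atoms ⊑-refl = here refl
∈-atoms (⊑-⊃ˡ q⊑α) = ∈-++⁺ˡ (∈-atoms q⊑α)
∈-atoms {φ = α ⊃ _} (⊑-⊃ʳ q⊑β) = ∈-++⁺ʳ (atoms α) (∈-atoms q⊑β)

size : Fm → ℕ
size (atom _) = 0
size (α ⊃ β) = suc (size α + size β)

module _ {A : Set} {P Q : Pred A 0ℓ} (P? : Decidable P) (Q? : Decidable Q)
         (P⇒Q : ∀ {x} → P x → Q x) where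

  length-filter-mono : ∀ xs → length (filter P? xs) ≤ length (filter Q? xs)
  length-filter-mono [] = z≤n
  length-filter-mono (x ∷ xs) with P? x | Q? x
  ... | yes _  | yes _  = s≤s (length-filter-mono xs)
  ... | yes px | no ¬qx = contradiction (P⇒Q px) ¬qx
  ... | no _   | yes _  = m≤n⇒m≤1+n (length-filter-mono xs)
  ... | no _   | no _   = length-filter-mono xs

  length-filter-mono-< : ∀ {x xs} → x ∈ xs → Q x → ¬ P x →
                         length (filter P? xs) < length (filter Q? xs)
  length-filter-mono-< {x} {_ ∷ xs} (here refl) qx ¬px with P? x | Q? x
  ... | yes px | _      = contradiction px ¬px
  ... | no _   | yes _  = s≤s (length-filter-mono xs)
  ... | no _   | no ¬qx = contradiction qx ¬qx
  length-filter-mono-< {xs = y ∷ _} (there x∈xs) qx ¬px with P? y | Q? y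
  ... | yes _  | yes _  = s≤s (length-filter-mono-< x∈xs qx ¬px)
  ... | yes py | no ¬qy = contradiction (P⇒Q py) ¬qy
  ... | no _   | yes _  = m≤n⇒m≤1+n (length-filter-mono-< x∈xs qx ¬px)
  ... | no _   | no _   = length-filter-mono-< x∈xs qx ¬px

module Unchosen {A : Set} (_≟ᴬ_ : DecidableEquality A) where
  open DecMembership _≟ᴬ_ using (_∉?_)

  unchosen : List A → List A → ℕ
  unchosen universe chosen = length (filter (_∉? chosen) universe)

  unchosen-∷-< : ∀ {x universe chosen} → x ∈ universe → x ∉ chosen →
                 unchosen universe (x ∷ chosen) < unchosen universe chosen
  unchosen-∷-< x∈universe x∉chosen =
    length-filter-mono-< (_∉? _) (_∉? _) (λ ∉x∷c → ∉x∷c ∘ there)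
                         x∈universe x∉chosen (λ ∉x∷c → ∉x∷c (here refl))

open Unchosen ℕ._≟_ renaming (unchosen to unchosenAtoms; unchosen-∷-< to unchosenAtoms-∷-<)
open Unchosen (≡-dec _≟_ ℕ._≟_) renaming (unchosen to unchosenContexts; unchosen-∷-< to unchosenContexts-∷-<)
open Unchosen _≟_ renaming (unchosen to unchosenFormulas; unchosen-∷-< to unchosenFormulas-∷-<)

addAtom⁺ : ∀ {P : Pred Atom 0ℓ} {q ps} → All P ps → P q → All P (addAtom q ps)
addAtom⁺ {q = q} {ps} all-ps pq with memᵇ q ps
... | true  = all-ps
... | false = ++⁺ all-ps (pq ∷ [])

Measure : Set
Measure = ℕ × ℕ × ℕ × ℕ

_≺_ : Rel Measure 0ℓ
_≺_ = ×-Lex _≡_ _<_ (×-Lex _≡_ _<_ (×-Lex _≡_ _<_ _<_))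

≺-wellFounded : WellFounded _≺_
≺-wellFounded =
  ×-wellFounded <-wellFounded (×-wellFounded <-wellFounded (×-wellFounded <-wellFounded <-wellFounded))

module Search (φ : Fm) where

  record Closed (s : State) : Set where
    constructor closed
    open State s
    field
      focused-⊑  : All (_⊑ φ) focused
      labelled-⊑ : All ((_⊑ φ) ∘ proj₁) labelled
      ctx-⊑      : All (_⊑ φ) ctx
      goal-⊑     : goal ⊑ φ
      area-⊑     : All (λ p → atom p ⊑ φ) area

  initial-closed : Closed (initial φ)
  initial-closed = closed [] [] [] ⊑-refl []

  contexts : List (Fm × Atom)
  contexts = cartesianProduct (subformulas φ) (atoms φ)

  measure : State → Measure
  measure (st F _ _ _ g R U) =
      unchosenAtoms (atoms φ) R
    , unchosenContexts contexts U
    , unchosenFormulas (subformulas φ) F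
    , size g

  expand-closed : ∀ {s ss} → Closed s → Expand s ss → All Closed ss
  expand-closed (closed F⊑ L⊑ D⊑ g⊑ A⊑) (⊃right α β) =
    closed F⊑ L⊑ (antecedent-⊑ g⊑ ∷ D⊑) (consequent-⊑ g⊑) A⊑ ∷ []
  expand-closed (closed F⊑ L⊑ D⊑ g⊑ A⊑) (focus _ _ _ α∈D _) =
    closed (lookup D⊑ α∈D ∷ F⊑) L⊑ D⊑ g⊑ A⊑ ∷ []
  expand-closed (closed F⊑ L⊑ D⊑ g⊑ A⊑) (⊃left _ _ _ _ _ α⊃β∈F _) =
      closed F⊑ (++⁺ L⊑ (map⁺ D⊑)) D⊑ (antecedent-⊑ (lookup F⊑ α⊃β∈F)) (addAtom⁺ A⊑ g⊑)
    ∷ closed F⊑ L⊑ (consequent-⊑ (lookup F⊑ α⊃β∈F) ∷ D⊑) g⊑ A⊑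
    ∷ []
  expand-closed (closed F⊑ L⊑ D⊑ g⊑ A⊑) (restart _ pre _ _ _ _ _ refl _ _) =
    closed [] (++⁺ (filter⁺ _ L⊑) (map⁺ D⊑)) (map⁺ (filter⁺ _ L⊑))
           (lookup A⊑ (∈-++⁺ʳ pre (here refl))) (addAtom⁺ A⊑ g⊑)
    ∷ []

  expand-≺ : ∀ {s ss} → Closed s → Expand s ss → All (λ s' → measure s' ≺ measure s) ss
  expand-≺ _ (⊃right α β) =
    inj₂ (refl , inj₂ (refl , inj₂ (refl , s≤s (m≤n+m (size β) (size α))))) ∷ []
  expand-≺ (closed _ _ D⊑ _ _) (focus _ _ _ α∈D α∉F) =
    inj₂ (refl , inj₂ (refl , inj₁ (unchosenFormulas-∷-< (∈-subformulas (lookup D⊑ α∈D)) α∉F))) ∷ []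
  expand-≺ {st _ _ _ _ _ _ U} (closed F⊑ _ _ g⊑ _) (⊃left q α β _ _ α⊃β∈F unused) =
    inj₂ (refl , inj₁ fresh) ∷ inj₂ (refl , inj₁ fresh) ∷ []
    where
    fresh : unchosenContexts contexts ((α ⊃ β , q) ∷ U) < unchosenContexts contexts U
    fresh = unchosenContexts-∷-<
              (∈-cartesianProduct⁺ (∈-subformulas (lookup F⊑ α⊃β∈F)) (∈-atoms g⊑)) unused
  expand-≺ (closed _ _ _ _ A⊑) (restart _ pre _ _ _ _ _ refl _ p∉R) =
    inj₁ (unchosenAtoms-∷-< (∈-atoms (lookup A⊑ (∈-++⁺ʳ pre (here refl)))) p∉R) ∷ []

  acc-closed : ∀ {s} → Closed s → Acc _≺_ (measure s) → Acc Child s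
  acc-closed c (acc rec) = acc λ { (_ , e , s'∈ss) →
    acc-closed (lookup (expand-closed c e) s'∈ss) (rec (lookup (expand-≺ c e) s'∈ss)) }

theorem3 : (φ : Fm) → Acc Child (initial φ)
theorem3 φ = acc-closed initial-closed (≺-wellFounded _)
  where open Search φ
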